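{- If $\mathbf A \in \mathcal A_8$, then $\mathbf A$ satisfies: (a) $x \to y' \approx x' \to y'$; (b) $x \to y' \approx 0 \to (y' \to x)$.
   Context: An $\mathcal I$-zroupoid is an algebra $\langle A,\to,0\rangle$ ($\to$ binary, $0$ constant) satisfying $(x \to y) \to z \approx [(z' \to x) \to (y \to z)']'$ and $0''\approx 0$, where $x' := x \to 0$ (prime binds tighter than $\to$); $\mathcal I$ is their variety. $\mathcal A_8$ is the subvariety of $\mathcal I$ defined by $x \to (y \to z) \approx (z \to x) \to y$. -}

module Defs where

open import Level using (Level; suc)
open import Relation.Binary.PropositionalEquality using (_≡_)

record Zroupoid (a : Level) : Set (suc a) where
  infixr 5 _⇒_
  field
    Carrier : Set a
    _⇒_     : Carrier → Carrier → Carrier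
    𝟘       : Carrier

  _′ : Carrier → Carrier
  x ′ = x ⇒ 𝟘
  infix 8 _′

record IsIZroupoid {a : Level} (A : Zroupoid a) : Set a where
  open Zroupoid A
  field
    I-axiom : ∀ x y z → (x ⇒ y) ⇒ z ≡ (((z ′) ⇒ x) ⇒ ((y ⇒ z) ′)) ′
    0''     : (𝟘 ′) ′ ≡ 𝟘

record InA8 {a : Level} (A : Zroupoid a) : Set a where
  open Zroupoid A
  field
    isI  : IsIZroupoid A
    A8-axiom : ∀ x y z → x ⇒ (y ⇒ z) ≡ (z ⇒ x) ⇒ y

-- In 𝓐₈ the constant acts as negation from the left, 0 → x = x′;
-- this and x′′′ = x′ follow from the 𝓐₈ law and 0′′ = 0 alone. They give
-- x′ → y = x → y′ and (x → y)′ = x → y′. The 𝓘-axiom with x := 0 expresses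
-- x → y′ through y′′ and (x → y)′, and by the previous identities this
-- expression does not change when y is replaced by y′; hence x → y′ = x → y′′
-- = x′ → y′, which is (a), and (b) is one more instance of the 𝓐₈ law.
module Submission where

open import Defs
open import Level using (Level)
open import Data.Product using (_×_; _,_)
open import Relation.Binary.PropositionalEquality
  using (_≡_; sym; cong; cong₂; module ≡-Reasoning)

module _ {a : Level} (A : Zroupoid a) where
  open Zroupoid A
  open ≡-Reasoning

  module A8-Properties
    (A8-axiom : ∀ x y z → x ⇒ y ⇒ z ≡ (z ⇒ x) ⇒ y)
    (0'' : 𝟘 ′ ′ ≡ 𝟘)
    where

    x⇒0′≡[0⇒x]′ : ∀ x → x ⇒ 𝟘 ′ ≡ (𝟘 ⇒ x) ′
    x⇒0′≡[0⇒x]′ x = A8-axiom x 𝟘 𝟘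

    0⇒[0⇒x]≡x′′ : ∀ x → 𝟘 ⇒ 𝟘 ⇒ x ≡ x ′ ′
    0⇒[0⇒x]≡x′′ x = A8-axiom 𝟘 𝟘 x

    0⇒x′≡0′⇒x : ∀ x → 𝟘 ⇒ x ′ ≡ 𝟘 ′ ⇒ x
    0⇒x′≡0′⇒x x = A8-axiom 𝟘 x 𝟘

    x′≡[0⇒x]⇒0′ : ∀ x → x ′ ≡ (𝟘 ⇒ x) ⇒ 𝟘 ′
    x′≡[0⇒x]⇒0′ x = begin
      x ⇒ 𝟘             ≡⟨ cong (x ⇒_) (sym 0'') ⟩
      x ⇒ 𝟘 ′ ⇒ 𝟘       ≡⟨ A8-axiom x (𝟘 ′) 𝟘 ⟩
      (𝟘 ⇒ x) ⇒ 𝟘 ′     ∎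

    0⇒x≡0⇒[x⇒0′] : ∀ x → 𝟘 ⇒ x ≡ 𝟘 ⇒ x ⇒ 𝟘 ′
    0⇒x≡0⇒[x⇒0′] x = begin
      𝟘 ⇒ x             ≡⟨ cong (_⇒ x) (sym 0'') ⟩
      (𝟘 ′ ⇒ 𝟘) ⇒ x     ≡⟨ A8-axiom 𝟘 x (𝟘 ′) ⟨
      𝟘 ⇒ x ⇒ 𝟘 ′       ∎

    0⇒x≡x′ : ∀ x → 𝟘 ⇒ x ≡ x ′
    0⇒x≡x′ x = begin
      𝟘 ⇒ x                    ≡⟨ 0⇒x≡0⇒[x⇒0′] x ⟩
      𝟘 ⇒ x ⇒ 𝟘 ′              ≡⟨ cong (𝟘 ⇒_) (x⇒0′≡[0⇒x]′ x) ⟩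
      𝟘 ⇒ (𝟘 ⇒ x) ′            ≡⟨ 0⇒x′≡0′⇒x (𝟘 ⇒ x) ⟩
      𝟘 ′ ⇒ 𝟘 ⇒ x              ≡⟨ A8-axiom (𝟘 ′) 𝟘 x ⟩
      (x ⇒ 𝟘 ′) ′              ≡⟨ x′≡[0⇒x]⇒0′ (x ⇒ 𝟘 ′) ⟩
      (𝟘 ⇒ x ⇒ 𝟘 ′) ⇒ 𝟘 ′      ≡⟨ cong (_⇒ 𝟘 ′) (0⇒x≡0⇒[x⇒0′] x) ⟨
      (𝟘 ⇒ x) ⇒ 𝟘 ′            ≡⟨ x′≡[0⇒x]⇒0′ x ⟨
      x ′                      ∎

    x′′′≡x′ : ∀ x → x ′ ′ ′ ≡ x ′
    x′′′≡x′ x = begin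
      x ′ ′ ′             ≡⟨ cong _′ (0⇒[0⇒x]≡x′′ x) ⟨
      (𝟘 ⇒ 𝟘 ⇒ x) ′       ≡⟨ x⇒0′≡[0⇒x]′ (𝟘 ⇒ x) ⟨
      (𝟘 ⇒ x) ⇒ 𝟘 ′       ≡⟨ x′≡[0⇒x]⇒0′ x ⟨
      x ′                 ∎

    x′⇒y≡x⇒y′ : ∀ x y → x ′ ⇒ y ≡ x ⇒ y ′
    x′⇒y≡x⇒y′ x y = begin
      x ′ ⇒ y             ≡⟨ cong (_⇒ y) (0⇒x≡x′ x) ⟨
      (𝟘 ⇒ x) ⇒ y         ≡⟨ A8-axiom x y 𝟘 ⟨
      x ⇒ y ′             ∎

    [x⇒y]′≡x⇒y′ : ∀ x y → (x ⇒ y) ′ ≡ x ⇒ y ′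
    [x⇒y]′≡x⇒y′ x y = begin
      (x ⇒ y) ′                ≡⟨ x′≡[0⇒x]⇒0′ (x ⇒ y) ⟩
      (𝟘 ⇒ x ⇒ y) ⇒ 𝟘 ′        ≡⟨ cong (_⇒ 𝟘 ′) (A8-axiom 𝟘 x y) ⟩
      (y ′ ⇒ x) ⇒ 𝟘 ′          ≡⟨ A8-axiom x (𝟘 ′) (y ′) ⟨
      x ⇒ 𝟘 ′ ⇒ y ′            ≡⟨ cong (x ⇒_) (0⇒x′≡0′⇒x (y ′)) ⟨
      x ⇒ 𝟘 ⇒ y ′ ′            ≡⟨ cong (x ⇒_) (0⇒x≡x′ (y ′ ′)) ⟩
      x ⇒ y ′ ′ ′              ≡⟨ cong (x ⇒_) (x′′′≡x′ y) ⟩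
      x ⇒ y ′                  ∎

    module _ (I-axiom : ∀ x y z → (x ⇒ y) ⇒ z ≡ ((z ′ ⇒ x) ⇒ (y ⇒ z) ′) ′) where

      x⇒y′≡[y′′⇒[x⇒y]′]′ : ∀ x y → x ⇒ y ′ ≡ (y ′ ′ ⇒ (x ⇒ y) ′) ′
      x⇒y′≡[y′′⇒[x⇒y]′]′ x y = begin
        x ⇒ y ′             ≡⟨ A8-axiom x y 𝟘 ⟩
        (𝟘 ⇒ x) ⇒ y         ≡⟨ I-axiom 𝟘 x y ⟩
        (y ′ ′ ⇒ (x ⇒ y) ′) ′ ∎

      x⇒y′≡x⇒y′′ : ∀ x y → x ⇒ y ′ ≡ x ⇒ y ′ ′
      x⇒y′≡x⇒y′′ x y = begin
        x ⇒ y ′                         ≡⟨ x⇒y′≡[y′′⇒[x⇒y]′]′ x y ⟩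
        (y ′ ′ ⇒ (x ⇒ y) ′) ′           ≡⟨ cong _′ (x′⇒y≡x⇒y′ (y ′) ((x ⇒ y) ′)) ⟩
        (y ′ ⇒ (x ⇒ y) ′ ′) ′           ≡⟨ cong₂ (λ u v → (u ⇒ v ′) ′) (sym (x′′′≡x′ y)) ([x⇒y]′≡x⇒y′ x y) ⟩
        (y ′ ′ ′ ⇒ (x ⇒ y ′) ′) ′       ≡⟨ x⇒y′≡[y′′⇒[x⇒y]′]′ x (y ′) ⟨
        x ⇒ y ′ ′                       ∎

lemma3p9 : ∀ {a : Level} (A : Zroupoid a) → InA8 A →
    let open Zroupoid A in
    (∀ x y → x ⇒ (y ′) ≡ (x ′) ⇒ (y ′))
    × (∀ x y → x ⇒ (y ′) ≡ 𝟘 ⇒ ((y ′) ⇒ x))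
lemma3p9 A isA8 = part-a , part-b
  where
  open Zroupoid A
  open InA8 isA8
  open IsIZroupoid isI
  open A8-Properties A A8-axiom 0''
  open ≡-Reasoning

  part-a : ∀ x y → x ⇒ y ′ ≡ x ′ ⇒ y ′
  part-a x y = begin
    x ⇒ y ′        ≡⟨ x⇒y′≡x⇒y′′ I-axiom x y ⟩
    x ⇒ y ′ ′      ≡⟨ x′⇒y≡x⇒y′ x (y ′) ⟨
    x ′ ⇒ y ′      ∎

  part-b : ∀ x y → x ⇒ y ′ ≡ 𝟘 ⇒ y ′ ⇒ x
  part-b x y = begin
    x ⇒ y ′        ≡⟨ part-a x y ⟩
    x ′ ⇒ y ′      ≡⟨ A8-axiom 𝟘 (y ′) x ⟨
    𝟘 ⇒ y ′ ⇒ x    ∎
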